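{- Let $0<\epsilon$ and let $G$ be an $n$-vertex graph having an $\epsilon$-nice partition into $k$ classes. Then $V(G)$ has an equipartition into $\lceil k/\epsilon\rceil$ classes such that all but at most a $3\epsilon$-fraction of the pairs of classes are homogeneous.
   Context: For an $n$-vertex graph $G$, a partition $V_1,\dots,V_k$ of $V(G)$ is $\epsilon$-nice if $\sum\frac{|V_i||V_j|}{n^2}<\epsilon$, the sum over pairs $(i,j)\in[k]^2$ with $(V_i,V_j)$ not homogeneous, where $(A,B)$ is homogeneous if either all pairs $\{a,b\}$, $a\in A$, $b\in B$, $a\neq b$, are edges or none are. An equipartition is a partition into parts whose sizes differ by at most $1$. For an equipartition into $K$ classes, "all but a $3\epsilon$-fraction of pairs are homogeneous" means at most $3\epsilon K^2$ of the pairs $(i,j)\in[K]^2$ are non-homogeneous. -}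

module Defs where

open import Data.Bool using (Bool; true; false; if_then_else_)
open import Data.Bool.Properties using () renaming (_≟_ to _≟ᵇ_)
open import Data.Nat using (ℕ; zero; suc; _+_; _*_; _≤_)
open import Data.Fin using (Fin; zero; suc; _≟_)
open import Data.Fin.Properties using (all?)
open import Data.Integer using (+_; ∣_∣)
open import Data.Rational using (ℚ; _/_; _÷_; Positive; ceiling)
open import Data.Rational.Properties using (pos⇒nonZero)
open import Data.Product using (_×_)
open import Data.Sum using (_⊎_)
open import Relation.Nullary using (Dec; does; ¬_; ¬?)
open import Relation.Nullary.Decidable using (_→-dec_; _⊎-dec_)
open import Relation.Binary.PropositionalEquality using (_≡_; _≢_)

record Graph (n : ℕ) : Set where
  field
    adj    : Fin n → Fin n → Bool
    sym    : ∀ a b → adj a b ≡ adj b a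
    irrefl : ∀ a → adj a a ≡ false
open Graph public

sumFin : ∀ {m} → (Fin m → ℕ) → ℕ
sumFin {zero}  f = 0
sumFin {suc m} f = f zero + sumFin (λ i → f (suc i))

ℕtoℚ : ℕ → ℚ
ℕtoℚ m = + m / 1

classSize : ∀ {n k} → (Fin n → Fin k) → Fin k → ℕ
classSize p i = sumFin (λ a → if does (p a ≟ i) then 1 else 0)

Homogeneous : ∀ {n k} → Graph n → (Fin n → Fin k) → Fin k → Fin k → Set
Homogeneous G p i j =
  (∀ a b → p a ≡ i → p b ≡ j → a ≢ b → adj G a b ≡ true) ⊎
  (∀ a b → p a ≡ i → p b ≡ j → a ≢ b → adj G a b ≡ false)

homogeneous? : ∀ {n k} (G : Graph n) (p : Fin n → Fin k) (i j : Fin k) →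
               Dec (Homogeneous G p i j)
homogeneous? G p i j = all? (λ a → all? (λ b → h a b true)) ⊎-dec all? (λ a → all? (λ b → h a b false))
  where
  h : ∀ a b c → Dec (p a ≡ i → p b ≡ j → a ≢ b → adj G a b ≡ c)
  h a b c = (p a ≟ i) →-dec ((p b ≟ j) →-dec (¬? (a ≟ b) →-dec (adj G a b ≟ᵇ c)))

nonHomWeight : ∀ {n k} → Graph n → (Fin n → Fin k) → ℕ
nonHomWeight G p = sumFin (λ i → sumFin (λ j →
  if does (homogeneous? G p i j) then 0 else classSize p i * classSize p j))

nonHomCount : ∀ {n k} → Graph n → (Fin n → Fin k) → ℕ
nonHomCount G p = sumFin (λ i → sumFin (λ j →
  if does (homogeneous? G p i j) then 0 else 1))

-- ε-nice: Σ |V_i||V_j| / n² < ε  (stated multiplied out: Σ |V_i||V_j| < ε n²).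
Nice : ∀ {n k} → ℚ → Graph n → (Fin n → Fin k) → Set
Nice {n} ε G p = ℕtoℚ (nonHomWeight G p) Data.Rational.< ε Data.Rational.* ℕtoℚ (n * n)

Equipartition : ∀ {n K} → (Fin n → Fin K) → Set
Equipartition p = ∀ i j → classSize p i ≤ suc (classSize p j)

ceilDiv : (k : ℕ) (ε : ℚ) → .{{Positive ε}} → ℕ
ceilDiv k ε = ∣ ceiling ((ℕtoℚ k ÷ ε) {{pos⇒nonZero ε}}) ∣

-- Let V_0, …, V_{k-1} be the nice partition, L_i = |V_i|, and W its
-- non-homogeneous weight Σ |V_i||V_i'|, so W < εn².  Cut the positions
-- 0, …, n-1 into the K intervals [⌈jn/K⌉, ⌈(j+1)n/K⌉); sending position x to
-- class ⌊xK/n⌋ is an equipartition, whatever bijection places the vertices.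
-- Part V_i is given c_i = ⌊L_i K/n⌋ consecutive whole intervals, filled by its
-- first vertices; all remaining vertices fill the positions after the last such
-- interval.  A class inside the intervals of V_i is a subset of V_i ("pure"), so
-- a pair of pure classes is homogeneous when its pair of parts is.  Hence the
-- pure non-homogeneous pairs number at most Σ c_i c_i' [V_i,V_i' non-hom] ≤
-- (K/n)² W, while the at most K - Σ c_i ≤ k impure classes meet at most 2Kk
-- pairs: (#non-hom pairs)·n² ≤ 2Kk n² + K² W.  With k ≤ εK this gives ≤ 3εK².

module Submission where

open import Data.Nat
open import Data.Nat.Properties
open import Data.Nat.DivMod using (_/_; _%_; m≡m%n+[m/n]*n; m%n<n; m/n*n≤m)
open import Data.Nat.Solver using (module +-*-Solver)
open import Algebra.Properties.CommutativeSemigroup +-commutativeSemigroup using (interchange)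
import Data.Integer as ℤ
import Data.Integer.Properties as ℤP
import Data.Integer.DivMod as ℤDM
open import Data.Rational as ℚ using (ℚ; Positive)
import Data.Rational.Properties as ℚP
open import Data.Rational.Solver using () renaming (module +-*-Solver to ℚ-Solver)
open import Data.Nat.Coprimality using (1-coprimeTo) renaming (sym to coprime-sym)
open import Data.Bool using (Bool; true; false; if_then_else_)
open import Data.Fin as F using (Fin; toℕ; fromℕ<)
open import Data.Fin.Properties using (toℕ<n; toℕ-fromℕ<; toℕ-injective)
open import Data.Product using (Σ-syntax; _×_; _,_; proj₁; proj₂)
open import Data.Sum using (inj₁; inj₂)
open import Data.Empty using (⊥-elim)
open import Relation.Nullary using (Dec; yes; no; ¬_; does)
open import Relation.Binary using (tri<; tri≈; tri>)
open import Relation.Binary.PropositionalEquality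
open import Defs hiding (sym)

Σ< : ℕ → (ℕ → ℕ) → ℕ
Σ< zero    f = 0
Σ< (suc N) f = f 0 + Σ< N (λ i → f (suc i))

Σ-last : ∀ N (f : ℕ → ℕ) → Σ< (suc N) f ≡ Σ< N f + f N
Σ-last zero    f = +-comm (f 0) 0
Σ-last (suc N) f =
  trans (cong (f 0 +_) (Σ-last N (λ i → f (suc i)))) (sym (+-assoc (f 0) _ _))

Σ-cong : ∀ N {f g : ℕ → ℕ} → (∀ i → i < N → f i ≡ g i) → Σ< N f ≡ Σ< N g
Σ-cong zero    eq = refl
Σ-cong (suc N) eq = cong₂ _+_ (eq 0 z<s) (Σ-cong N (λ i i<N → eq (suc i) (s≤s i<N)))

Σ-mono : ∀ N {f g : ℕ → ℕ} → (∀ i → i < N → f i ≤ g i) → Σ< N f ≤ Σ< N g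
Σ-mono zero    le = z≤n
Σ-mono (suc N) le = +-mono-≤ (le 0 z<s) (Σ-mono N (λ i i<N → le (suc i) (s≤s i<N)))

Σ-split : ∀ a b (f : ℕ → ℕ) → Σ< (a + b) f ≡ Σ< a f + Σ< b (λ t → f (a + t))
Σ-split zero    b f = refl
Σ-split (suc a) b f =
  trans (cong (f 0 +_) (Σ-split a b (λ i → f (suc i)))) (sym (+-assoc (f 0) _ _))

Σ-prefix : ∀ j N (f : ℕ → ℕ) → j ≤ N → Σ< j f ≤ Σ< N f
Σ-prefix j N f j≤N = begin
  Σ< j f                                   ≤⟨ m≤m+n _ _ ⟩
  Σ< j f + Σ< (N ∸ j) (λ t → f (j + t))     ≡⟨ sym (Σ-split j (N ∸ j) f) ⟩
  Σ< (j + (N ∸ j)) f                        ≡⟨ cong (λ z → Σ< z f) (m+[n∸m]≡n j≤N) ⟩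
  Σ< N f                                   ∎
  where open ≤-Reasoning

Σ-+ : ∀ N (f g : ℕ → ℕ) → Σ< N (λ i → f i + g i) ≡ Σ< N f + Σ< N g
Σ-+ zero    f g = refl
Σ-+ (suc N) f g = trans (cong (f 0 + g 0 +_) (Σ-+ N (λ i → f (suc i)) (λ i → g (suc i))))
                        (interchange (f 0) (g 0) _ _)

Σ-const : ∀ N c → Σ< N (λ _ → c) ≡ N * c
Σ-const zero    c = refl
Σ-const (suc N) c = cong (c +_) (Σ-const N c)

Σ-zeros : ∀ N (f : ℕ → ℕ) → (∀ i → i < N → f i ≡ 0) → Σ< N f ≡ 0
Σ-zeros N f eq = trans (Σ-cong N eq) (trans (Σ-const N 0) (*-zeroʳ N))

Σ-bound : ∀ N b (f : ℕ → ℕ) → (∀ i → f i ≤ b) → Σ< N f ≤ N * b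
Σ-bound N b f le = subst (Σ< N f ≤_) (Σ-const N b) (Σ-mono N (λ i _ → le i))

Σ-*ˡ : ∀ N c (f : ℕ → ℕ) → Σ< N (λ i → c * f i) ≡ c * Σ< N f
Σ-*ˡ zero    c f = sym (*-zeroʳ c)
Σ-*ˡ (suc N) c f =
  trans (cong (c * f 0 +_) (Σ-*ˡ N c (λ i → f (suc i)))) (sym (*-distribˡ-+ c (f 0) _))

Σ-*ʳ : ∀ N c (f : ℕ → ℕ) → Σ< N (λ i → f i * c) ≡ Σ< N f * c
Σ-*ʳ N c f = trans (Σ-cong N (λ i _ → *-comm (f i) c)) (trans (Σ-*ˡ N c f) (*-comm c _))

Σ-swap : ∀ N M (f : ℕ → ℕ → ℕ) →
  Σ< N (λ i → Σ< M (f i)) ≡ Σ< M (λ j → Σ< N (λ i → f i j))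
Σ-swap zero    M f = sym (Σ-zeros M _ (λ _ _ → refl))
Σ-swap (suc N) M f = trans (cong (Σ< M (f 0) +_) (Σ-swap N M (λ i → f (suc i))))
                           (sym (Σ-+ M (f 0) (λ j → Σ< N (λ i → f (suc i) j))))

Σ≡0⇒ : ∀ N (f : ℕ → ℕ) → Σ< N f ≡ 0 → ∀ i → i < N → f i ≡ 0
Σ≡0⇒ (suc N) f eq zero    _         = m+n≡0⇒m≡0 (f 0) eq
Σ≡0⇒ (suc N) f eq (suc i) (s≤s i<N) = Σ≡0⇒ N (λ j → f (suc j)) (m+n≡0⇒n≡0 (f 0) eq) i i<N

Σ-concat : ∀ k (D d f : ℕ → ℕ) → D 0 ≡ 0 → (∀ i → D (suc i) ≡ D i + d i) →
  Σ< k (λ i → Σ< (d i) (λ t → f (D i + t))) ≡ Σ< (D k) f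
Σ-concat zero    D d f D0 Ds = cong (λ z → Σ< z f) (sym D0)
Σ-concat (suc k) D d f D0 Ds = begin
  Σ< (suc k) (λ i → Σ< (d i) (λ t → f (D i + t)))
    ≡⟨ Σ-last k _ ⟩
  Σ< k (λ i → Σ< (d i) (λ t → f (D i + t))) + Σ< (d k) (λ t → f (D k + t))
    ≡⟨ cong (_+ Σ< (d k) (λ t → f (D k + t))) (Σ-concat k D d f D0 Ds) ⟩
  Σ< (D k) f + Σ< (d k) (λ t → f (D k + t))
    ≡⟨ sym (Σ-split (D k) (d k) f) ⟩
  Σ< (D k + d k) f
    ≡⟨ cong (λ z → Σ< z f) (sym (Ds k)) ⟩
  Σ< (D (suc k)) f ∎
  where open ≡-Reasoning

⟦_⟧ : {P : Set} → Dec P → ℕ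
⟦ d ⟧ = if does d then 1 else 0

⟦yes⟧ : {P : Set} (d : Dec P) → P → ⟦ d ⟧ ≡ 1
⟦yes⟧ (yes _) _ = refl
⟦yes⟧ (no ¬p) p = ⊥-elim (¬p p)

⟦no⟧ : {P : Set} (d : Dec P) → ¬ P → ⟦ d ⟧ ≡ 0
⟦no⟧ (yes p) ¬p = ⊥-elim (¬p p)
⟦no⟧ (no _)  _  = refl

⟦⟧-cong : {P Q : Set} (d : Dec P) (e : Dec Q) → (P → Q) → (Q → P) → ⟦ d ⟧ ≡ ⟦ e ⟧
⟦⟧-cong (yes p) e to from = sym (⟦yes⟧ e (to p))
⟦⟧-cong (no ¬p) e to from = sym (⟦no⟧ e (λ q → ¬p (from q)))

failure-anti : {P Q : Set} (d : Dec P) (e : Dec Q) → (P → Q) →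
  (if does e then 0 else 1) ≤ (if does d then 0 else 1)
failure-anti d       (yes _) to = z≤n
failure-anti (no _)  (no _)  to = ≤-refl
failure-anti (yes p) (no ¬q) to = ⊥-elim (¬q (to p))

eqInd : ℕ → ℕ → ℕ
eqInd x y = ⟦ x ≟ y ⟧

geInd : ℕ → ℕ → ℕ
geInd b x = ⟦ b ≤? x ⟧

Σ-delta : ∀ N x (F : ℕ → ℕ) → x < N → Σ< N (λ i → eqInd x i * F i) ≡ F x
Σ-delta (suc N) zero    F _ =
  trans (cong₂ _+_ (*-identityˡ (F 0)) (Σ-zeros N _ (λ _ _ → refl))) (+-identityʳ (F 0))
Σ-delta (suc N) (suc x) F (s≤s x<N) = Σ-delta N x (λ i → F (suc i)) x<N

geInd-suc : ∀ b x → geInd (suc b) (suc x) ≡ geInd b x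
geInd-suc b x = ⟦⟧-cong (suc b ≤? suc x) (b ≤? x) s≤s⁻¹ s≤s

Σ-geInd : ∀ N b → Σ< N (geInd b) ≡ N ∸ b
Σ-geInd N       zero    = trans (Σ-const N 1) (*-identityʳ N)
Σ-geInd zero    (suc b) = refl
Σ-geInd (suc N) (suc b) = trans (Σ-cong N (λ x _ → geInd-suc b x)) (Σ-geInd N b)

eq+gt≡ge : ∀ c j → eqInd c j + geInd (suc j) c ≡ geInd j c
eq+gt≡ge zero    zero    = refl
eq+gt≡ge zero    (suc j) = refl
eq+gt≡ge (suc c) zero    = refl
eq+gt≡ge (suc c) (suc j) =
  trans (cong (eqInd c j +_) (geInd-suc (suc j) c)) (trans (eq+gt≡ge c j) (sym (geInd-suc j c)))

-- The interval equipartition of the positions [0, n) into K classes.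
module Rounding (n' K' : ℕ) where

  n K : ℕ
  n = suc n'
  K = suc K'

  -- firstPos j = ⌈jn/K⌉ is the first position of class j.
  firstPos : ℕ → ℕ
  firstPos j = (j * n + K') / K

  firstPos-hi : ∀ j → firstPos j * K ≤ j * n + K'
  firstPos-hi j = m/n*n≤m (j * n + K') K

  firstPos-lo : ∀ j → j * n ≤ firstPos j * K
  firstPos-lo j = +-cancelʳ-≤ K' (j * n) (firstPos j * K) (begin
    j * n + K'                            ≡⟨ m≡m%n+[m/n]*n (j * n + K') K ⟩
    (j * n + K') % K + firstPos j * K        ≤⟨ +-monoˡ-≤ (firstPos j * K) (s≤s⁻¹ (m%n<n (j * n + K') K)) ⟩
    K' + firstPos j * K                      ≡⟨ +-comm K' _ ⟩
    firstPos j * K + K'                      ∎)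
    where open ≤-Reasoning

  firstPos-least : ∀ j x → j * n ≤ x * K → firstPos j ≤ x
  firstPos-least j x le with firstPos j ≤? x
  ... | yes p = p
  ... | no ¬p = ⊥-elim (<-irrefl refl (begin-strict
    j * n + K'        <⟨ +-monoʳ-< (j * n) (n<1+n K') ⟩
    j * n + K         ≤⟨ +-monoˡ-≤ K le ⟩
    x * K + K         ≡⟨ +-comm (x * K) K ⟩
    suc x * K         ≤⟨ *-monoˡ-≤ K (≰⇒> ¬p) ⟩
    firstPos j * K       ≤⟨ firstPos-hi j ⟩
    j * n + K'        ∎))
    where open ≤-Reasoning

  firstPos-mono : ∀ {i j} → i ≤ j → firstPos i ≤ firstPos j
  firstPos-mono {i} {j} i≤j = firstPos-least i (firstPos j) (≤-trans (*-monoˡ-≤ n i≤j) (firstPos-lo j))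

  firstPos-0 : firstPos 0 ≡ 0
  firstPos-0 = n≤0⇒n≡0 (firstPos-least 0 0 z≤n)

  firstPos-K : firstPos K ≡ n
  firstPos-K = ≤-antisym (firstPos-least K n (≤-reflexive (*-comm K n)))
    (*-cancelʳ-≤ n (firstPos K) K (subst (_≤ firstPos K * K) (*-comm K n) (firstPos-lo K)))

  classOf : ℕ → ℕ
  classOf x = (x * K) / n

  classOf-lo : ∀ x → classOf x * n ≤ x * K
  classOf-lo x = m/n*n≤m (x * K) n

  classOf-hi : ∀ x → x * K < suc (classOf x) * n
  classOf-hi x = begin-strict
    x * K                        ≡⟨ m≡m%n+[m/n]*n (x * K) n ⟩
    x * K % n + classOf x * n    <⟨ +-monoˡ-< (classOf x * n) (m%n<n (x * K) n) ⟩
    suc (classOf x) * n          ∎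
    where open ≤-Reasoning

  ≤classOf⇒ : ∀ j x → j ≤ classOf x → firstPos j ≤ x
  ≤classOf⇒ j x le = firstPos-least j x (≤-trans (*-monoˡ-≤ n le) (classOf-lo x))

  firstPos≤⇒ : ∀ j x → firstPos j ≤ x → j ≤ classOf x
  firstPos≤⇒ j x le with j ≤? classOf x
  ... | yes p = p
  ... | no ¬p = ⊥-elim (<-irrefl refl (begin-strict
    j * n                 ≤⟨ firstPos-lo j ⟩
    firstPos j * K           ≤⟨ *-monoˡ-≤ K le ⟩
    x * K                 <⟨ classOf-hi x ⟩
    suc (classOf x) * n   ≤⟨ *-monoˡ-≤ n (≰⇒> ¬p) ⟩
    j * n                 ∎))
    where open ≤-Reasoning

  classOf<K : ∀ x → x < n → classOf x < K
  classOf<K x x<n = *-cancelʳ-< n (classOf x) K (begin-strict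
    classOf x * n   ≤⟨ classOf-lo x ⟩
    x * K           <⟨ *-monoˡ-< K x<n ⟩
    n * K           ≡⟨ *-comm n K ⟩
    K * n           ∎)
    where open ≤-Reasoning

  classCount : ∀ j → j < K → Σ< n (λ x → eqInd (classOf x) j) ≡ firstPos (suc j) ∸ firstPos j
  classCount j j<K = +-cancelʳ-≡ (n ∸ b) _ (b ∸ a) (begin
    Σ< n (λ x → eqInd (classOf x) j) + (n ∸ b)
      ≡⟨ cong (Σ< n (λ x → eqInd (classOf x) j) +_) (sym (Σ-geInd n b)) ⟩
    Σ< n (λ x → eqInd (classOf x) j) + Σ< n (geInd b)
      ≡⟨ sym (Σ-+ n (λ x → eqInd (classOf x) j) (geInd b)) ⟩
    Σ< n (λ x → eqInd (classOf x) j + geInd b x)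
      ≡⟨ Σ-cong n (λ x _ → step x) ⟩
    Σ< n (geInd a)
      ≡⟨ Σ-geInd n a ⟩
    n ∸ a
      ≡⟨ cong (_∸ a) (sym (m+[n∸m]≡n b≤n)) ⟩
    b + (n ∸ b) ∸ a
      ≡⟨ +-∸-comm (n ∸ b) a≤b ⟩
    b ∸ a + (n ∸ b) ∎)
    where
    open ≡-Reasoning
    a = firstPos j
    b = firstPos (suc j)
    a≤b : a ≤ b
    a≤b = firstPos-mono (n≤1+n j)
    b≤n : b ≤ n
    b≤n = subst (b ≤_) firstPos-K (firstPos-mono j<K)
    galois : ∀ i x → geInd (firstPos i) x ≡ geInd i (classOf x)
    galois i x = ⟦⟧-cong (firstPos i ≤? x) (i ≤? classOf x) (firstPos≤⇒ i x) (≤classOf⇒ i x)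
    step : ∀ x → eqInd (classOf x) j + geInd b x ≡ geInd a x
    step x = trans (cong (eqInd (classOf x) j +_) (galois (suc j) x))
                   (trans (eq+gt≡ge (classOf x) j) (sym (galois j x)))

  m : ℕ
  m = n / K

  firstPos-step-hi : ∀ j → firstPos (suc j) ≤ firstPos j + suc m
  firstPos-step-hi j = firstPos-least (suc j) (firstPos j + suc m) (begin
    suc j * n                     ≡⟨ +-comm n (j * n) ⟩
    j * n + n                     ≤⟨ +-mono-≤ (firstPos-lo j) (<⇒≤ n<sm*K) ⟩
    firstPos j * K + suc m * K       ≡⟨ sym (*-distribʳ-+ K (firstPos j) (suc m)) ⟩
    (firstPos j + suc m) * K         ∎)
    where
    open ≤-Reasoning
    n<sm*K : n < suc m * K
    n<sm*K = begin-strict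
      n                  ≡⟨ m≡m%n+[m/n]*n n K ⟩
      n % K + m * K      <⟨ +-monoˡ-< (m * K) (m%n<n n K) ⟩
      suc m * K          ∎

  firstPos-step-lo : ∀ j → firstPos j + m ≤ firstPos (suc j)
  firstPos-step-lo j with firstPos j + m ≤? firstPos (suc j)
  ... | yes p = p
  ... | no ¬p = ⊥-elim (<-irrefl refl (begin-strict
    j * n + K' + n             <⟨ +-monoˡ-< n (+-monoʳ-< (j * n) (n<1+n K')) ⟩
    j * n + K + n              ≡⟨ solve 3 (λ jn K n → jn :+ K :+ n := K :+ (n :+ jn)) refl (j * n) K n ⟩
    K + suc j * n              ≤⟨ +-monoʳ-≤ K (firstPos-lo (suc j)) ⟩
    suc (firstPos (suc j)) * K    ≤⟨ *-monoˡ-≤ K (≰⇒> ¬p) ⟩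
    (firstPos j + m) * K          ≡⟨ *-distribʳ-+ K (firstPos j) m ⟩
    firstPos j * K + m * K        ≤⟨ +-mono-≤ (firstPos-hi j) (m/n*n≤m n K) ⟩
    j * n + K' + n             ∎))
    where
    open ≤-Reasoning
    open +-*-Solver

  classSize-lo : ∀ j → m ≤ firstPos (suc j) ∸ firstPos j
  classSize-lo j = subst (_≤ firstPos (suc j) ∸ firstPos j) (m+n∸m≡n (firstPos j) m)
                         (∸-monoˡ-≤ (firstPos j) (firstPos-step-lo j))

  classSize-hi : ∀ j → firstPos (suc j) ∸ firstPos j ≤ suc m
  classSize-hi j = subst (firstPos (suc j) ∸ firstPos j ≤_) (m+n∸m≡n (firstPos j) (suc m))
                         (∸-monoˡ-≤ (firstPos j) (firstPos-step-hi j))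

-- Each part i is given wholeClasses i
-- consecutive whole classes of the interval equipartition, occupied by its first
-- vertices; the rest of all parts is put behind the last of these classes.
module Placement (n' K' k : ℕ) (part : ℕ → ℕ) (part<k : ∀ a → a < suc n' → part a < k) where

  open Rounding n' K' public

  rank : ℕ → ℕ → ℕ
  rank i a = Σ< a (λ b → eqInd (part b) i)

  partSize : ℕ → ℕ
  partSize i = rank i n

  rankInPart : ℕ → ℕ
  rankInPart a = rank (part a) a

  wholeClasses : ℕ → ℕ
  wholeClasses i = (partSize i * K) / n

  wholeClasses-lo : ∀ i → wholeClasses i * n ≤ partSize i * K
  wholeClasses-lo i = m/n*n≤m (partSize i * K) n

  wholeClasses-hi : ∀ i → partSize i * K ≤ suc (wholeClasses i) * n
  wholeClasses-hi i = begin
    partSize i * K                                         ≡⟨ m≡m%n+[m/n]*n (partSize i * K) n ⟩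
    partSize i * K % n + wholeClasses i * n                ≤⟨ +-monoˡ-≤ _ (<⇒≤ (m%n<n (partSize i * K) n)) ⟩
    suc (wholeClasses i) * n                               ∎
    where open ≤-Reasoning

  classesBefore : ℕ → ℕ
  classesBefore i = Σ< i wholeClasses

  classesBefore-suc : ∀ i → classesBefore (suc i) ≡ classesBefore i + wholeClasses i
  classesBefore-suc i = Σ-last i wholeClasses

  classesBefore-mono : ∀ {i j} → i ≤ j → classesBefore i ≤ classesBefore j
  classesBefore-mono {i} {j} = Σ-prefix i j wholeClasses

  blockLen : ℕ → ℕ
  blockLen i = firstPos (classesBefore (suc i)) ∸ firstPos (classesBefore i)

  firstPos-blockLen : ∀ i → firstPos (classesBefore (suc i)) ≡ firstPos (classesBefore i) + blockLen i
  firstPos-blockLen i = sym (m+[n∸m]≡n (firstPos-mono (classesBefore-mono (n≤1+n i))))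

  blockLen≤partSize : ∀ i → blockLen i ≤ partSize i
  blockLen≤partSize i = begin
    firstPos (classesBefore (suc i)) ∸ S      ≡⟨ cong (λ z → firstPos z ∸ S) (classesBefore-suc i) ⟩
    firstPos (classesBefore i + c) ∸ S        ≤⟨ ∸-monoˡ-≤ S (firstPos-least (classesBefore i + c) (S + partSize i) enough) ⟩
    S + partSize i ∸ S                     ≡⟨ m+n∸m≡n S (partSize i) ⟩
    partSize i                             ∎
    where
    open ≤-Reasoning
    S = firstPos (classesBefore i)
    c = wholeClasses i
    enough : (classesBefore i + c) * n ≤ (S + partSize i) * K
    enough = begin
      (classesBefore i + c) * n          ≡⟨ *-distribʳ-+ n (classesBefore i) c ⟩
      classesBefore i * n + c * n        ≤⟨ +-mono-≤ (firstPos-lo (classesBefore i)) (wholeClasses-lo i) ⟩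
      S * K + partSize i * K             ≡⟨ sym (*-distribʳ-+ K S (partSize i)) ⟩
      (S + partSize i) * K               ∎

  leftover : ℕ → ℕ
  leftover i = partSize i ∸ blockLen i

  leftoverBefore : ℕ → ℕ
  leftoverBefore i = Σ< i leftover

  tailStart : ℕ
  tailStart = firstPos (classesBefore k)

  Σ-partSize : Σ< k partSize ≡ n
  Σ-partSize = begin
    Σ< k (λ i → Σ< n (λ a → eqInd (part a) i))   ≡⟨ Σ-swap k n (λ i a → eqInd (part a) i) ⟩
    Σ< n (λ a → Σ< k (λ i → eqInd (part a) i))   ≡⟨ Σ-cong n (λ a a<n → one a a<n) ⟩
    Σ< n (λ _ → 1)                               ≡⟨ trans (Σ-const n 1) (*-identityʳ n) ⟩
    n                                            ∎
    where
    open ≡-Reasoning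
    one : ∀ a → a < n → Σ< k (λ i → eqInd (part a) i) ≡ 1
    one a a<n = trans (Σ-cong k (λ i _ → sym (*-identityʳ (eqInd (part a) i))))
                      (Σ-delta k (part a) (λ _ → 1) (part<k a a<n))

  Σ-blockLen : ∀ i → Σ< i blockLen ≡ firstPos (classesBefore i)
  Σ-blockLen zero    = sym firstPos-0
  Σ-blockLen (suc i) = trans (Σ-last i blockLen)
    (trans (cong (_+ blockLen i) (Σ-blockLen i)) (sym (firstPos-blockLen i)))

  tailStart+leftovers : tailStart + leftoverBefore k ≡ n
  tailStart+leftovers = begin
    tailStart + leftoverBefore k                 ≡⟨ +-comm tailStart _ ⟩
    leftoverBefore k + tailStart                 ≡⟨ cong (leftoverBefore k +_) (sym (Σ-blockLen k)) ⟩
    leftoverBefore k + Σ< k blockLen             ≡⟨ sym (Σ-+ k leftover blockLen) ⟩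
    Σ< k (λ i → leftover i + blockLen i)         ≡⟨ Σ-cong k (λ i _ → m∸n+n≡m (blockLen≤partSize i)) ⟩
    Σ< k partSize                                ≡⟨ Σ-partSize ⟩
    n                                            ∎
    where open ≡-Reasoning

  -- Regrouping a sum over vertices by parts: a ↦ (part a, rankInPart a) is a bijection
  -- from [0, n) onto the pairs (i, t) with t < partSize i.
  Σ-byRank : ∀ i N (f : ℕ → ℕ) → Σ< N (λ a → eqInd (part a) i * f (rank i a)) ≡ Σ< (rank i N) f
  Σ-byRank i zero    f = refl
  Σ-byRank i (suc N) f = begin
    Σ< (suc N) (λ a → eqInd (part a) i * f (rank i a))
      ≡⟨ Σ-last N _ ⟩
    Σ< N (λ a → eqInd (part a) i * f (rank i a)) + eqInd (part N) i * f (rank i N)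
      ≡⟨ cong (_+ eqInd (part N) i * f (rank i N)) (Σ-byRank i N f) ⟩
    Σ< (rank i N) f + eqInd (part N) i * f (rank i N)
      ≡⟨ extend (part N ≟ i) ⟩
    Σ< (rank i N + eqInd (part N) i) f
      ≡⟨ cong (λ z → Σ< z f) (sym (Σ-last N (λ b → eqInd (part b) i))) ⟩
    Σ< (rank i (suc N)) f ∎
    where
    open ≡-Reasoning
    extend : (d : Dec (part N ≡ i)) → Σ< (rank i N) f + ⟦ d ⟧ * f (rank i N) ≡ Σ< (rank i N + ⟦ d ⟧) f
    extend (yes _) = trans (cong (Σ< (rank i N) f +_) (+-identityʳ _))
      (trans (sym (Σ-last (rank i N) f)) (cong (λ z → Σ< z f) (+-comm 1 (rank i N))))
    extend (no _)  = trans (+-identityʳ _) (cong (λ z → Σ< z f) (sym (+-identityʳ (rank i N))))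

  Σ-byPart : ∀ (g : ℕ → ℕ → ℕ) →
    Σ< n (λ a → g (part a) (rankInPart a)) ≡ Σ< k (λ i → Σ< (partSize i) (g i))
  Σ-byPart g = begin
    Σ< n (λ a → g (part a) (rankInPart a))
      ≡⟨ Σ-cong n (λ a a<n → sym (Σ-delta k (part a) (λ i → g i (rank i a)) (part<k a a<n))) ⟩
    Σ< n (λ a → Σ< k (λ i → eqInd (part a) i * g i (rank i a)))
      ≡⟨ Σ-swap n k (λ a i → eqInd (part a) i * g i (rank i a)) ⟩
    Σ< k (λ i → Σ< n (λ a → eqInd (part a) i * g i (rank i a)))
      ≡⟨ Σ-cong k (λ i _ → Σ-byRank i n (g i)) ⟩
    Σ< k (λ i → Σ< (partSize i) (g i)) ∎
    where open ≡-Reasoning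

  positionBy : ∀ i t → Dec (t < blockLen i) → ℕ
  positionBy i t (yes _) = firstPos (classesBefore i) + t
  positionBy i t (no _)  = tailStart + leftoverBefore i + (t ∸ blockLen i)

  position : ℕ → ℕ → ℕ
  position i t = positionBy i t (t <? blockLen i)

  position-block : ∀ i t → t < blockLen i → position i t ≡ firstPos (classesBefore i) + t
  position-block i t lt with t <? blockLen i
  ... | yes _ = refl
  ... | no ¬p = ⊥-elim (¬p lt)

  position-tail : ∀ i t → ¬ t < blockLen i → position i t ≡ tailStart + leftoverBefore i + (t ∸ blockLen i)
  position-tail i t nlt with t <? blockLen i
  ... | yes p = ⊥-elim (nlt p)
  ... | no _  = refl

  Σ-positionOfPart : ∀ (f : ℕ → ℕ) i → Σ< (partSize i) (λ t → f (position i t)) ≡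
    Σ< (blockLen i) (λ t → f (firstPos (classesBefore i) + t)) +
    Σ< (leftover i) (λ s → f (tailStart + (leftoverBefore i + s)))
  Σ-positionOfPart f i = begin
    Σ< (partSize i) (λ t → f (position i t))
      ≡⟨ cong (λ z → Σ< z (λ t → f (position i t))) (sym (m+[n∸m]≡n (blockLen≤partSize i))) ⟩
    Σ< (blockLen i + leftover i) (λ t → f (position i t))
      ≡⟨ Σ-split (blockLen i) (leftover i) _ ⟩
    Σ< (blockLen i) (λ t → f (position i t)) + Σ< (leftover i) (λ s → f (position i (blockLen i + s)))
      ≡⟨ cong₂ _+_ (Σ-cong (blockLen i) (λ t lt → cong f (position-block i t lt)))
                   (Σ-cong (leftover i) (λ s _ → cong f tail-eq)) ⟩
    Σ< (blockLen i) (λ t → f (firstPos (classesBefore i) + t)) +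
    Σ< (leftover i) (λ s → f (tailStart + (leftoverBefore i + s))) ∎
    where
    open ≡-Reasoning
    tail-eq : ∀ {s} → position i (blockLen i + s) ≡ tailStart + (leftoverBefore i + s)
    tail-eq {s} = trans (position-tail i (blockLen i + s) (m+n≮m (blockLen i) s))
      (trans (cong (tailStart + leftoverBefore i +_) (m+n∸m≡n (blockLen i) s))
             (+-assoc tailStart (leftoverBefore i) s))

  Σ-position : ∀ (f : ℕ → ℕ) → Σ< k (λ i → Σ< (partSize i) (λ t → f (position i t))) ≡ Σ< n f
  Σ-position f = begin
    Σ< k (λ i → Σ< (partSize i) (λ t → f (position i t)))
      ≡⟨ Σ-cong k (λ i _ → Σ-positionOfPart f i) ⟩
    Σ< k (λ i → Σ< (blockLen i) (λ t → f (firstPos (classesBefore i) + t)) +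
                Σ< (leftover i) (λ s → f (tailStart + (leftoverBefore i + s))))
      ≡⟨ Σ-+ k _ _ ⟩
    Σ< k (λ i → Σ< (blockLen i) (λ t → f (firstPos (classesBefore i) + t))) +
    Σ< k (λ i → Σ< (leftover i) (λ s → f (tailStart + (leftoverBefore i + s))))
      ≡⟨ cong₂ _+_ (Σ-concat k (λ i → firstPos (classesBefore i)) blockLen f firstPos-0 firstPos-blockLen)
                   (Σ-concat k leftoverBefore leftover (λ y → f (tailStart + y)) refl (λ i → Σ-last i leftover)) ⟩
    Σ< tailStart f + Σ< (leftoverBefore k) (λ y → f (tailStart + y))
      ≡⟨ sym (Σ-split tailStart (leftoverBefore k) f) ⟩
    Σ< (tailStart + leftoverBefore k) f
      ≡⟨ cong (λ z → Σ< z f) tailStart+leftovers ⟩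
    Σ< n f ∎
    where open ≡-Reasoning

  place : ℕ → ℕ
  place a = position (part a) (rankInPart a)

  -- place is a bijection of [0, n): it preserves all sums.
  Σ-place : ∀ (f : ℕ → ℕ) → Σ< n (λ a → f (place a)) ≡ Σ< n f
  Σ-place f = trans (Σ-byPart (λ i t → f (position i t))) (Σ-position f)

  place<n : ∀ a → a < n → place a < n
  place<n a a<n with n ≤? place a
  ... | no ¬p = ≰⇒> ¬p
  ... | yes p = ⊥-elim (1≢0 (trans (sym (⟦yes⟧ (n ≤? place a) p))
                             (Σ≡0⇒ n (λ b → geInd n (place b)) none a a<n)))
    where
    1≢0 : 1 ≢ 0
    1≢0 ()
    none : Σ< n (λ b → geInd n (place b)) ≡ 0
    none = trans (Σ-place (geInd n)) (trans (Σ-geInd n n) (n∸n≡0 n))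

  classesBefore-k≤K : classesBefore k ≤ K
  classesBefore-k≤K = *-cancelʳ-≤ (classesBefore k) K n (begin
    classesBefore k * n                      ≡⟨ sym (Σ-*ʳ k n wholeClasses) ⟩
    Σ< k (λ i → wholeClasses i * n)          ≤⟨ Σ-mono k (λ i _ → wholeClasses-lo i) ⟩
    Σ< k (λ i → partSize i * K)              ≡⟨ Σ-*ʳ k K partSize ⟩
    Σ< k partSize * K                        ≡⟨ cong (_* K) Σ-partSize ⟩
    n * K                                    ≡⟨ *-comm n K ⟩
    K * n                                    ∎)
    where open ≤-Reasoning

  K≤k+classesBefore-k : K ≤ k + classesBefore k
  K≤k+classesBefore-k = *-cancelˡ-≤ n (begin
    n * K                                    ≡⟨ cong (_* K) (sym Σ-partSize) ⟩
    Σ< k partSize * K                        ≡⟨ sym (Σ-*ʳ k K partSize) ⟩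
    Σ< k (λ i → partSize i * K)              ≤⟨ Σ-mono k (λ i _ → wholeClasses-hi i) ⟩
    Σ< k (λ i → suc (wholeClasses i) * n)    ≡⟨ Σ-*ʳ k n (λ i → suc (wholeClasses i)) ⟩
    Σ< k (λ i → 1 + wholeClasses i) * n      ≡⟨ cong (_* n) (Σ-+ k (λ _ → 1) wholeClasses) ⟩
    (Σ< k (λ _ → 1) + classesBefore k) * n   ≡⟨ cong (λ z → (z + classesBefore k) * n) (trans (Σ-const k 1) (*-identityʳ k)) ⟩
    (k + classesBefore k) * n                ≡⟨ *-comm (k + classesBefore k) n ⟩
    n * (k + classesBefore k)                ∎)
    where open ≤-Reasoning

  ownerUnique : ∀ i i' v → classesBefore i ≤ v → v < classesBefore (suc i) →
    classesBefore i' ≤ v → v < classesBefore (suc i') → i ≡ i'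
  ownerUnique i i' v lo hi lo' hi' with <-cmp i i'
  ... | tri≈ _ e _ = e
  ... | tri< lt _ _ = ⊥-elim (<-irrefl refl (<-≤-trans hi (≤-trans (classesBefore-mono lt) lo')))
  ... | tri> _ _ gt = ⊥-elim (<-irrefl refl (<-≤-trans hi' (≤-trans (classesBefore-mono gt) lo)))

  pure : ∀ a → a < n → classOf (place a) < classesBefore k →
    classesBefore (part a) ≤ classOf (place a) × classOf (place a) < classesBefore (suc (part a))
  pure a a<n inWhole = byBlock (rankInPart a <? blockLen i)
    where
    i = part a
    S = firstPos (classesBefore i)
    byBlock : Dec (rankInPart a < blockLen i) →
      classesBefore i ≤ classOf (place a) × classOf (place a) < classesBefore (suc i)
    byBlock (no out) = ⊥-elim (<-irrefl refl (≤-trans inWhole (firstPos≤⇒ _ _ tail≤place)))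
      where
      tail≤place : tailStart ≤ place a
      tail≤place = subst (tailStart ≤_) (sym (position-tail i (rankInPart a) out))
                         (≤-trans (m≤m+n tailStart _) (m≤m+n _ _))
    byBlock (yes inBlock) = firstPos≤⇒ _ _ (subst (S ≤_) (sym place≡) (m≤m+n S _)) , below
      where
      place≡ : place a ≡ S + rankInPart a
      place≡ = position-block i (rankInPart a) inBlock
      below : classOf (place a) < classesBefore (suc i)
      below = ≰⇒> λ le → <-irrefl refl (begin-strict
        S + rankInPart a                 <⟨ +-monoʳ-< S inBlock ⟩
        S + blockLen i                   ≡⟨ sym (firstPos-blockLen i) ⟩
        firstPos (classesBefore (suc i))    ≤⟨ ≤classOf⇒ _ _ le ⟩
        place a                          ≡⟨ place≡ ⟩
        S + rankInPart a                 ∎)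
        where open ≤-Reasoning

Σ² : ℕ → (ℕ → ℕ → ℕ) → ℕ
Σ² N M = Σ< N (λ j → Σ< N (M j))

Σ-restrict : ∀ N C b (f : ℕ → ℕ) → C ≤ N → (∀ i → f i ≤ b) → Σ< N f ≤ Σ< C f + (N ∸ C) * b
Σ-restrict N C b f C≤N le = begin
  Σ< N f                                     ≡⟨ cong (λ z → Σ< z f) (sym (m+[n∸m]≡n C≤N)) ⟩
  Σ< (C + (N ∸ C)) f                         ≡⟨ Σ-split C (N ∸ C) f ⟩
  Σ< C f + Σ< (N ∸ C) (λ t → f (C + t))      ≤⟨ +-monoʳ-≤ (Σ< C f) (Σ-bound (N ∸ C) b _ (λ t → le (C + t))) ⟩
  Σ< C f + (N ∸ C) * b                       ∎
  where open ≤-Reasoning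

-- Restricting a 0/1 matrix on [K]² to [C]² loses at most 2K(K ∸ C) entries:
-- those in the last K ∸ C rows or columns.
Σ²-restrict : ∀ K C (M : ℕ → ℕ → ℕ) → C ≤ K → (∀ j j' → M j j' ≤ 1) →
  Σ² K M ≤ Σ² C M + 2 * K * (K ∸ C)
Σ²-restrict K C M C≤K le1 = begin
  Σ< K (λ j → Σ< K (M j))                        ≤⟨ Σ-restrict K C K _ C≤K row≤K ⟩
  Σ< C (λ j → Σ< K (M j)) + D * K                ≤⟨ +-monoˡ-≤ (D * K) (Σ-mono C (λ j _ → row j)) ⟩
  Σ< C (λ j → Σ< C (M j) + D * 1) + D * K        ≡⟨ cong (_+ D * K) (trans (Σ-+ C _ _) (cong (Σ² C M +_) (Σ-const C (D * 1)))) ⟩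
  Σ² C M + C * (D * 1) + D * K                   ≤⟨ +-monoˡ-≤ (D * K) (+-monoʳ-≤ (Σ² C M) (*-monoˡ-≤ (D * 1) C≤K)) ⟩
  Σ² C M + K * (D * 1) + D * K                   ≡⟨ solve 3 (λ S K D → S :+ K :* (D :* con 1) :+ D :* K := S :+ con 2 :* K :* D) refl (Σ² C M) K D ⟩
  Σ² C M + 2 * K * D                             ∎
  where
  open ≤-Reasoning
  open +-*-Solver
  D = K ∸ C
  row : ∀ j → Σ< K (M j) ≤ Σ< C (M j) + D * 1
  row j = Σ-restrict K C 1 (M j) C≤K (le1 j)
  row≤K : ∀ j → Σ< K (M j) ≤ K
  row≤K j = subst (Σ< K (M j) ≤_) (*-identityʳ K) (Σ-bound K 1 (M j) (le1 j))

Σ²-blocks : ∀ k (c : ℕ → ℕ) (M E : ℕ → ℕ → ℕ) →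
  (∀ i i' t t' → i < k → i' < k → t < c i → t' < c i' → M (Σ< i c + t) (Σ< i' c + t') ≤ E i i') →
  Σ² (Σ< k c) M ≤ Σ< k (λ i → c i * Σ< k (λ i' → c i' * E i i'))
Σ²-blocks k c M E bounded = begin
  Σ< (Σ< k c) (λ j → Σ< (Σ< k c) (M j))
    ≡⟨ byBlocks _ ⟩
  Σ< k (λ i → Σ< (c i) (λ t → Σ< (Σ< k c) (M (Σ< i c + t))))
    ≡⟨ Σ-cong k (λ i _ → Σ-cong (c i) (λ t _ → byBlocks _)) ⟩
  Σ< k (λ i → Σ< (c i) (λ t → Σ< k (λ i' → Σ< (c i') (λ t' → M (Σ< i c + t) (Σ< i' c + t')))))
    ≤⟨ Σ-mono k (λ i i<k → Σ-mono (c i) (λ t t< → Σ-mono k (λ i' i'<k → Σ-mono (c i') (λ t' t'< →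
         bounded i i' t t' i<k i'<k t< t'<)))) ⟩
  Σ< k (λ i → Σ< (c i) (λ t → Σ< k (λ i' → Σ< (c i') (λ t' → E i i'))))
    ≡⟨ Σ-cong k (λ i _ → trans (Σ-const (c i) _) (cong (c i *_) (Σ-cong k (λ i' _ → Σ-const (c i') _)))) ⟩
  Σ< k (λ i → c i * Σ< k (λ i' → c i' * E i i')) ∎
  where
  open ≤-Reasoning
  byBlocks : ∀ f → Σ< (Σ< k c) f ≡ Σ< k (λ i → Σ< (c i) (λ t → f (Σ< i c + t)))
  byBlocks f = sym (Σ-concat k (λ i → Σ< i c) c f refl (λ i → Σ-last i c))

Σ²-rescale : ∀ k (c L : ℕ → ℕ) (E : ℕ → ℕ → ℕ) n K → (∀ i → c i * n ≤ L i * K) →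
  Σ< k (λ i → c i * Σ< k (λ i' → c i' * E i i')) * (n * n) ≤
  K * K * Σ< k (λ i → Σ< k (λ i' → E i i' * (L i * L i')))
Σ²-rescale k c L E n K le = begin
  Σ< k (λ i → c i * Σ< k (λ i' → c i' * E i i')) * (n * n)
    ≡⟨ sym (Σ-*ʳ k (n * n) _) ⟩
  Σ< k (λ i → c i * Σ< k (λ i' → c i' * E i i') * (n * n))
    ≡⟨ Σ-cong k (λ i _ → trans (cong (_* (n * n)) (sym (Σ-*ˡ k (c i) _))) (sym (Σ-*ʳ k (n * n) _))) ⟩
  Σ< k (λ i → Σ< k (λ i' → c i * (c i' * E i i') * (n * n)))
    ≡⟨ Σ-cong k (λ i _ → Σ-cong k (λ i' _ → regroupₗ (c i) (c i') (E i i') n)) ⟩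
  Σ< k (λ i → Σ< k (λ i' → (c i * n) * (c i' * n) * E i i'))
    ≤⟨ Σ-mono k (λ i _ → Σ-mono k (λ i' _ → *-monoˡ-≤ (E i i') (*-mono-≤ (le i) (le i')))) ⟩
  Σ< k (λ i → Σ< k (λ i' → (L i * K) * (L i' * K) * E i i'))
    ≡⟨ Σ-cong k (λ i _ → Σ-cong k (λ i' _ → regroupᵣ (L i) (L i') (E i i') K)) ⟩
  Σ< k (λ i → Σ< k (λ i' → K * K * (E i i' * (L i * L i'))))
    ≡⟨ Σ-cong k (λ i _ → Σ-*ˡ k (K * K) _) ⟩
  Σ< k (λ i → K * K * Σ< k (λ i' → E i i' * (L i * L i')))
    ≡⟨ Σ-*ˡ k (K * K) _ ⟩
  K * K * Σ< k (λ i → Σ< k (λ i' → E i i' * (L i * L i'))) ∎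
  where
  open ≤-Reasoning
  open +-*-Solver
  regroupₗ : ∀ a b e n → a * (b * e) * (n * n) ≡ (a * n) * (b * n) * e
  regroupₗ = solve 4 (λ a b e n → a :* (b :* e) :* (n :* n) := (a :* n) :* (b :* n) :* e) refl
  regroupᵣ : ∀ a b e K → (a * K) * (b * K) * e ≡ K * K * (e * (a * b))
  regroupᵣ = solve 4 (λ a b e K → (a :* K) :* (b :* K) :* e := K :* K :* (e :* (a :* b))) refl

ℕtoℚ≡ : ∀ m → ℕtoℚ m ≡ ℚ.mkℚ (ℤ.+ m) 0 (coprime-sym (1-coprimeTo m))
ℕtoℚ≡ m = ℚP.normalize-coprime (coprime-sym (1-coprimeTo m))

ℕtoℚ-+ : ∀ a b → ℕtoℚ (a + b) ≡ ℕtoℚ a ℚ.+ ℕtoℚ b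
ℕtoℚ-+ a b = trans (cong (ℚ._/ 1) (trans (ℤP.pos-+ a b) (sym (cong₂ ℤ._+_ (ℤP.*-identityʳ (ℤ.+ a)) (ℤP.*-identityʳ (ℤ.+ b))))))
                   (cong₂ ℚ._+_ (sym (ℕtoℚ≡ a)) (sym (ℕtoℚ≡ b)))

ℕtoℚ-* : ∀ a b → ℕtoℚ (a * b) ≡ ℕtoℚ a ℚ.* ℕtoℚ b
ℕtoℚ-* a b = trans (cong (ℚ._/ 1) (ℤP.pos-* a b)) (cong₂ ℚ._*_ (sym (ℕtoℚ≡ a)) (sym (ℕtoℚ≡ b)))

ℕtoℚ-mono : ∀ {a b} → a ≤ b → ℕtoℚ a ℚ.≤ ℕtoℚ b
ℕtoℚ-mono {a} {b} a≤b = subst₂ ℚ._≤_ (sym (ℕtoℚ≡ a)) (sym (ℕtoℚ≡ b))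
  (ℚ.*≤* (subst₂ ℤ._≤_ (sym (ℤP.*-identityʳ (ℤ.+ a))) (sym (ℤP.*-identityʳ (ℤ.+ b))) (ℤ.+≤+ a≤b)))

ℕtoℚ-cancel : ∀ {a b} → ℕtoℚ a ℚ.≤ ℕtoℚ b → a ≤ b
ℕtoℚ-cancel {a} {b} le with subst₂ ℚ._≤_ (ℕtoℚ≡ a) (ℕtoℚ≡ b) le
... | ℚ.*≤* a≤b with subst₂ ℤ._≤_ (ℤP.*-identityʳ (ℤ.+ a)) (ℤP.*-identityʳ (ℤ.+ b)) a≤b
...   | ℤ.+≤+ le' = le'

ℕtoℚ-nonNeg : ∀ m → ℚ.NonNegative (ℕtoℚ m)
ℕtoℚ-nonNeg m = subst ℚ.NonNegative (sym (ℕtoℚ≡ m)) _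

ℕtoℚ-pos : ∀ m → 0 < m → ℚ.Positive (ℕtoℚ m)
ℕtoℚ-pos (suc m) _ = subst ℚ.Positive (sym (ℕtoℚ≡ (suc m))) _

*-ℕtoℚ0 : ∀ x → x ℚ.* ℕtoℚ 0 ≡ ℕtoℚ 0
*-ℕtoℚ0 x = trans (cong (x ℚ.*_) (ℕtoℚ≡ 0)) (trans (ℚP.*-zeroʳ x) (sym (ℕtoℚ≡ 0)))

-- Every rational is at most the absolute value of its ceiling: ⌈x⌉ = - ⌊- x⌋ is
-- computed by integer division of the numerator of - x.
≤∣ceiling∣ : ∀ x → x ℚ.≤ ℕtoℚ ℤ.∣ ℚ.ceiling x ∣
≤∣ceiling∣ x@(ℚ.mkℚ (ℤ.+ zero) b _) = subst (x ℚ.≤_) (sym (ℕtoℚ≡ ℤ.∣ ℚ.ceiling x ∣))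
  (ℚ.*≤* (subst (ℤ._≤_ (ℤ.+ 0)) (ℤP.pos-* ℤ.∣ ℚ.ceiling x ∣ (suc b)) (ℤ.+≤+ z≤n)))
≤∣ceiling∣ x@(ℚ.mkℚ ℤ.-[1+ a ] b _) = subst (x ℚ.≤_) (sym (ℕtoℚ≡ ℤ.∣ ℚ.ceiling x ∣))
  (ℚ.*≤* (subst (ℤ._≤_ (ℤ.-[1+ a ] ℤ.* ℤ.+ 1)) (ℤP.pos-* ℤ.∣ ℚ.ceiling x ∣ (suc b)) ℤ.-≤+))
≤∣ceiling∣ x@(ℚ.mkℚ (ℤ.+ suc a) b _) = subst (x ℚ.≤_) (sym (ℕtoℚ≡ ℤ.∣ ℚ.ceiling x ∣)) (ℚ.*≤* (begin
  ℤ.+ suc a ℤ.* ℤ.+ 1                  ≡⟨ ℤP.*-identityʳ (ℤ.+ suc a) ⟩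
  ℤ.+ suc a                            ≤⟨ ℤP.neg-mono-≤ (ℤDM.[n/d]*d≤n ℤ.-[1+ a ] d) ⟩
  ℤ.- (F ℤ.* d)                        ≡⟨ ℤP.neg-distribˡ-* F d ⟩
  (ℤ.- F) ℤ.* d                        ≤⟨ ℤP.*-monoʳ-≤-nonNeg d (≤+∣∣ (ℤ.- F)) ⟩
  ℤ.+ ℤ.∣ ℤ.- F ∣ ℤ.* d                ∎))
  where
  open ℤP.≤-Reasoning
  d = ℤ.+ suc b
  F = ℤ.-[1+ a ] ℤ./ d
  ≤+∣∣ : ∀ i → i ℤ.≤ ℤ.+ ℤ.∣ i ∣
  ≤+∣∣ (ℤ.+ _)     = ℤP.≤-refl
  ≤+∣∣ ℤ.-[1+ _ ] = ℤ.-≤+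

k≤ε*ceilDiv : (ε : ℚ) .{{_ : Positive ε}} (k : ℕ) → ℕtoℚ k ℚ.≤ ε ℚ.* ℕtoℚ (ceilDiv k ε)
k≤ε*ceilDiv ε k = subst (ℚ._≤ ε ℚ.* ℕtoℚ (ceilDiv k ε)) ε*k/ε≡k
  (ℚP.*-monoˡ-≤-nonNeg ε {{ℚP.pos⇒nonNeg ε}} (≤∣ceiling∣ (ℕtoℚ k ℚ.÷ ε)))
  where
  instance _ = ℚP.pos⇒nonZero ε
  ε*k/ε≡k : ε ℚ.* (ℕtoℚ k ℚ.÷ ε) ≡ ℕtoℚ k
  ε*k/ε≡k = begin
    ε ℚ.* (ℕtoℚ k ℚ.* ℚ.1/ ε)      ≡⟨ sym (ℚP.*-assoc ε (ℕtoℚ k) (ℚ.1/ ε)) ⟩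
    ε ℚ.* ℕtoℚ k ℚ.* ℚ.1/ ε        ≡⟨ cong (ℚ._* ℚ.1/ ε) (ℚP.*-comm ε (ℕtoℚ k)) ⟩
    ℕtoℚ k ℚ.* ε ℚ.* ℚ.1/ ε        ≡⟨ ℚP.*-assoc (ℕtoℚ k) ε (ℚ.1/ ε) ⟩
    ℕtoℚ k ℚ.* (ε ℚ.* ℚ.1/ ε)      ≡⟨ cong (ℕtoℚ k ℚ.*_) (ℚP.*-inverseʳ ε) ⟩
    ℕtoℚ k ℚ.* ℚ.1ℚ                ≡⟨ ℚP.*-identityʳ (ℕtoℚ k) ⟩
    ℕtoℚ k                         ∎
    where open ≡-Reasoning

k≤εK⇒K>0 : ∀ ε {k K} → 0 < k → ℕtoℚ k ℚ.≤ ε ℚ.* ℕtoℚ K → 0 < K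
k≤εK⇒K>0 ε {k} {zero}  k>0 le = ⊥-elim (<⇒≱ k>0 (ℕtoℚ-cancel (subst (ℕtoℚ k ℚ.≤_) (*-ℕtoℚ0 ε) le)))
k≤εK⇒K>0 ε {k} {suc K} k>0 le = z<s

fraction-bound : (ε : ℚ) .{{_ : Positive ε}} (n k K X W : ℕ) → 0 < n →
  ℕtoℚ W ℚ.< ε ℚ.* ℕtoℚ (n * n) → ℕtoℚ k ℚ.≤ ε ℚ.* ℕtoℚ K →
  X * (n * n) ≤ 2 * K * k * (n * n) + K * K * W →
  ℕtoℚ X ℚ.≤ ℕtoℚ 3 ℚ.* ε ℚ.* ℕtoℚ (K * K)
fraction-bound ε n@(suc _) k K X W _ W<εn² k≤εK counted =
  ℚP.*-cancelʳ-≤-pos N {{ℕtoℚ-pos (n * n) z<s}} (begin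
    ℕtoℚ X ℚ.* N                                          ≡⟨ sym (ℕtoℚ-* X (n * n)) ⟩
    ℕtoℚ (X * (n * n))                                    ≤⟨ ℕtoℚ-mono counted ⟩
    ℕtoℚ (2 * K * k * (n * n) + K * K * W)                ≡⟨ embed ⟩
    ℕtoℚ 2 ℚ.* K̂ ℚ.* ℕtoℚ k ℚ.* N ℚ.+ K̂ ℚ.* K̂ ℚ.* ℕtoℚ W
      ≤⟨ ℚP.+-mono-≤ (ℚP.*-monoʳ-≤-nonNeg N (ℚP.*-monoˡ-≤-nonNeg (ℕtoℚ 2 ℚ.* K̂) {{nonNeg² (ℕtoℚ 2) K̂}} k≤εK))
                     (ℚP.*-monoˡ-≤-nonNeg (K̂ ℚ.* K̂) {{nonNeg² K̂ K̂}} (ℚP.<⇒≤ W<εn²)) ⟩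
    ℕtoℚ 2 ℚ.* K̂ ℚ.* (ε ℚ.* K̂) ℚ.* N ℚ.+ K̂ ℚ.* K̂ ℚ.* (ε ℚ.* N)
      ≡⟨ collect ⟩
    ℕtoℚ 3 ℚ.* ε ℚ.* ℕtoℚ (K * K) ℚ.* N                  ∎)
  where
  open ℚP.≤-Reasoning
  N K̂ : ℚ
  N = ℕtoℚ (n * n)
  K̂ = ℕtoℚ K
  instance
    _ = ℚP.pos⇒nonNeg ε
    _ = ℕtoℚ-nonNeg (n * n)
    _ = ℕtoℚ-nonNeg K
    _ = ℕtoℚ-nonNeg 2
  nonNeg² : ∀ a b → .{{ℚ.NonNegative a}} → .{{ℚ.NonNegative b}} → ℚ.NonNegative (a ℚ.* b)
  nonNeg² a b = ℚP.nonNeg*nonNeg⇒nonNeg a b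
  embed : ℕtoℚ (2 * K * k * (n * n) + K * K * W) ≡ ℕtoℚ 2 ℚ.* K̂ ℚ.* ℕtoℚ k ℚ.* N ℚ.+ K̂ ℚ.* K̂ ℚ.* ℕtoℚ W
  embed = trans (ℕtoℚ-+ (2 * K * k * (n * n)) (K * K * W)) (cong₂ ℚ._+_
    (trans (ℕtoℚ-* (2 * K * k) (n * n)) (cong (ℚ._* N) (trans (ℕtoℚ-* (2 * K) k) (cong (ℚ._* ℕtoℚ k) (ℕtoℚ-* 2 K)))))
    (trans (ℕtoℚ-* (K * K) W) (cong (ℚ._* ℕtoℚ W) (ℕtoℚ-* K K))))
  collect : ℕtoℚ 2 ℚ.* K̂ ℚ.* (ε ℚ.* K̂) ℚ.* N ℚ.+ K̂ ℚ.* K̂ ℚ.* (ε ℚ.* N) ≡ ℕtoℚ 3 ℚ.* ε ℚ.* ℕtoℚ (K * K) ℚ.* N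
  collect = trans
    (ℚ-Solver.solve 4 (λ t k e m → t :* k :* (e :* k) :* m :+ k :* k :* (e :* m) := (t :+ con ℚ.1ℚ) :* e :* (k :* k) :* m)
                     refl (ℕtoℚ 2) K̂ ε N)
    (cong₂ (λ three KK → three ℚ.* ε ℚ.* KK ℚ.* N) (sym (ℕtoℚ-+ 2 1)) (sym (ℕtoℚ-* K K)))
    where open ℚ-Solver

-- The extension by zero of a function on Fin N, so that Fin-indexed sums can be
-- handled as Σ<.
onℕ : ∀ {N} → (Fin N → ℕ) → ℕ → ℕ
onℕ {zero}  f _       = 0
onℕ {suc N} f zero    = f F.zero
onℕ {suc N} f (suc x) = onℕ (λ i → f (F.suc i)) x

onℕ-toℕ : ∀ {N} (f : Fin N → ℕ) (i : Fin N) → onℕ f (toℕ i) ≡ f i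
onℕ-toℕ {suc N} f F.zero    = refl
onℕ-toℕ {suc N} f (F.suc i) = onℕ-toℕ (λ j → f (F.suc j)) i

onℕ-fromℕ< : ∀ {N} (f : Fin N → ℕ) x (x<N : x < N) → onℕ f x ≡ f (fromℕ< x<N)
onℕ-fromℕ< f x x<N = trans (cong (onℕ f) (sym (toℕ-fromℕ< x<N))) (onℕ-toℕ f (fromℕ< x<N))

onℕ-≤ : ∀ {N} (f : Fin N → ℕ) b → (∀ i → f i ≤ b) → ∀ x → onℕ f x ≤ b
onℕ-≤ {zero}  f b le x       = z≤n
onℕ-≤ {suc N} f b le zero    = le F.zero
onℕ-≤ {suc N} f b le (suc x) = onℕ-≤ (λ i → f (F.suc i)) b (λ i → le (F.suc i)) x

sumFin≡Σ< : ∀ m (f : Fin m → ℕ) (g : ℕ → ℕ) → (∀ i → f i ≡ g (toℕ i)) → sumFin f ≡ Σ< m g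
sumFin≡Σ< zero    f g eq = refl
sumFin≡Σ< (suc m) f g eq =
  cong₂ _+_ (eq F.zero) (sumFin≡Σ< m (λ i → f (F.suc i)) (λ i → g (suc i)) (λ i → eq (F.suc i)))

eqInd-toℕ : ∀ {N} (x y : Fin N) → ⟦ x F.≟ y ⟧ ≡ eqInd (toℕ x) (toℕ y)
eqInd-toℕ x y = ⟦⟧-cong (x F.≟ y) (toℕ x ≟ toℕ y) (cong toℕ) toℕ-injective

nonHom : ∀ {n K} → Graph n → (Fin n → Fin K) → Fin K → Fin K → ℕ
nonHom G q J J' = if does (homogeneous? G q J J') then 0 else 1

nonHom≤1 : ∀ {n K} (G : Graph n) (q : Fin n → Fin K) J J' → nonHom G q J J' ≤ 1
nonHom≤1 G q J J' with does (homogeneous? G q J J')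
... | true  = z≤n
... | false = ≤-refl

homogeneous-⊆ : ∀ {n k K} (G : Graph n) (p : Fin n → Fin k) (q : Fin n → Fin K) {J J' I I'} →
  (∀ a → q a ≡ J → p a ≡ I) → (∀ b → q b ≡ J' → p b ≡ I') →
  Homogeneous G p I I' → Homogeneous G q J J'
homogeneous-⊆ G p q J⊆I J'⊆I' (inj₁ allEdges) =
  inj₁ (λ a b qa qb a≢b → allEdges a b (J⊆I a qa) (J'⊆I' b qb) a≢b)
homogeneous-⊆ G p q J⊆I J'⊆I' (inj₂ noEdges)  =
  inj₂ (λ a b qa qb a≢b → noEdges a b (J⊆I a qa) (J'⊆I' b qb) a≢b)

nonHom-⊆ : ∀ {n k K} (G : Graph n) (p : Fin n → Fin k) (q : Fin n → Fin K) {J J' I I'} →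
  (∀ a → q a ≡ J → p a ≡ I) → (∀ b → q b ≡ J' → p b ≡ I') →
  nonHom G q J J' ≤ nonHom G p I I'
nonHom-⊆ G p q J⊆I J'⊆I' =
  failure-anti (homogeneous? G p _ _) (homogeneous? G q _ _) (homogeneous-⊆ G p q J⊆I J'⊆I')

if0-* : ∀ (b : Bool) x → (if b then 0 else x) ≡ (if b then 0 else 1) * x
if0-* true  x = refl
if0-* false x = sym (+-identityʳ x)

module Construction (n' K' k : ℕ) (G : Graph (suc n')) (p : Fin (suc n') → Fin k) where

  partℕ : ℕ → ℕ
  partℕ = onℕ (λ a → toℕ (p a))

  partℕ-toℕ : ∀ a → partℕ (toℕ a) ≡ toℕ (p a)
  partℕ-toℕ = onℕ-toℕ (λ a → toℕ (p a))

  partℕ<k : ∀ a → a < suc n' → partℕ a < k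
  partℕ<k a a<n = subst (_< k) (sym (onℕ-fromℕ< (λ a → toℕ (p a)) a a<n)) (toℕ<n _)

  open Placement n' K' k partℕ partℕ<k public

  q : Fin n → Fin K
  q a = fromℕ< (classOf<K (place (toℕ a)) (place<n (toℕ a) (toℕ<n a)))

  toℕ-q : ∀ a → toℕ (q a) ≡ classOf (place (toℕ a))
  toℕ-q a = toℕ-fromℕ< _

  classSize-q : ∀ j → classSize q j ≡ firstPos (suc (toℕ j)) ∸ firstPos (toℕ j)
  classSize-q j = begin
    classSize q j                                              ≡⟨ sumFin≡Σ< n _ (λ a → eqInd (classOf (place a)) (toℕ j)) (λ a →
      trans (eqInd-toℕ (q a) j) (cong (λ z → eqInd z (toℕ j)) (toℕ-q a))) ⟩
    Σ< n (λ a → eqInd (classOf (place a)) (toℕ j))             ≡⟨ Σ-place (λ x → eqInd (classOf x) (toℕ j)) ⟩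
    Σ< n (λ x → eqInd (classOf x) (toℕ j))                     ≡⟨ classCount (toℕ j) (toℕ<n j) ⟩
    firstPos (suc (toℕ j)) ∸ firstPos (toℕ j)                  ∎
    where open ≡-Reasoning

  q-equipartition : Equipartition q
  q-equipartition i j = subst₂ (λ x y → x ≤ suc y) (sym (classSize-q i)) (sym (classSize-q j))
    (≤-trans (classSize-hi (toℕ i)) (s≤s (classSize-lo (toℕ j))))

  classSize-p : ∀ I → classSize p I ≡ partSize (toℕ I)
  classSize-p I = sumFin≡Σ< n _ (λ a → eqInd (partℕ a) (toℕ I)) (λ a →
    trans (eqInd-toℕ (p a) I) (cong (λ z → eqInd z (toℕ I)) (sym (partℕ-toℕ a))))

  nonHomℕ-q : ℕ → ℕ → ℕ
  nonHomℕ-q j j' = onℕ (λ J → onℕ (nonHom G q J) j') j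

  nonHomℕ-p : ℕ → ℕ → ℕ
  nonHomℕ-p i i' = onℕ (λ I → onℕ (nonHom G p I) i') i

  nonHomℕ-q≤1 : ∀ j j' → nonHomℕ-q j j' ≤ 1
  nonHomℕ-q≤1 j j' = onℕ-≤ _ 1 (λ J → onℕ-≤ (nonHom G q J) 1 (nonHom≤1 G q J) j') j

  nonHomℕ-fromℕ< : ∀ {N} (r : Fin n → Fin N) i i' (i<N : i < N) (i'<N : i' < N) →
    onℕ (λ I → onℕ (nonHom G r I) i') i ≡ nonHom G r (fromℕ< i<N) (fromℕ< i'<N)
  nonHomℕ-fromℕ< r i i' i<N i'<N =
    trans (onℕ-fromℕ< (λ I → onℕ (nonHom G r I) i') i i<N) (onℕ-fromℕ< (nonHom G r (fromℕ< i<N)) i' i'<N)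

  nonHomCount-q : nonHomCount G q ≡ Σ² K nonHomℕ-q
  nonHomCount-q = sumFin≡Σ< K _ (λ j → Σ< K (nonHomℕ-q j)) (λ J →
    trans (sumFin≡Σ< K _ (λ j' → onℕ (nonHom G q J) j') (λ J' → sym (onℕ-toℕ (nonHom G q J) J')))
          (Σ-cong K (λ j' _ → sym (onℕ-toℕ (λ J → onℕ (nonHom G q J) j') J))))

  nonHomWeight-p : nonHomWeight G p ≡ Σ< k (λ i → Σ< k (λ i' → nonHomℕ-p i i' * (partSize i * partSize i')))
  nonHomWeight-p = sumFin≡Σ< k _ _ (λ I → sumFin≡Σ< k _ _ (λ I' →
    trans (if0-* (does (homogeneous? G p I I')) _)
          (cong₂ _*_ (sym (trans (onℕ-toℕ (λ I → onℕ (nonHom G p I) (toℕ I')) I) (onℕ-toℕ (nonHom G p I) I')))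
                     (cong₂ _*_ (classSize-p I) (classSize-p I')))))

  wholeClass⊆part : ∀ i t (i<k : i < k) → t < wholeClasses i → (lt : classesBefore i + t < K) →
    ∀ a → q a ≡ fromℕ< lt → p a ≡ fromℕ< i<k
  wholeClass⊆part i t i<k t<c lt a qa = toℕ-injective (begin
    toℕ (p a)            ≡⟨ sym (partℕ-toℕ a) ⟩
    partℕ (toℕ a)        ≡⟨ ownerUnique _ i v (proj₁ inPart) (proj₂ inPart) (subst (classesBefore i ≤_) (sym v≡) (m≤m+n _ _)) v<next ⟩
    i                    ≡⟨ sym (toℕ-fromℕ< i<k) ⟩
    toℕ (fromℕ< i<k)     ∎)
    where
    open ≡-Reasoning
    v = classOf (place (toℕ a))
    v≡ : v ≡ classesBefore i + t
    v≡ = trans (sym (toℕ-q a)) (trans (cong toℕ qa) (toℕ-fromℕ< lt))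
    v<next : v < classesBefore (suc i)
    v<next = subst (_< classesBefore (suc i)) (sym v≡)
               (subst (classesBefore i + t <_) (sym (classesBefore-suc i)) (+-monoʳ-< (classesBefore i) t<c))
    inPart = pure (toℕ a) (toℕ<n a) (<-≤-trans v<next (classesBefore-mono i<k))

  -- Whole classes are pure, so on pairs of them q is no less homogeneous than p.
  nonHom-wholeClasses : ∀ i i' t t' → i < k → i' < k → t < wholeClasses i → t' < wholeClasses i' →
    nonHomℕ-q (classesBefore i + t) (classesBefore i' + t') ≤ nonHomℕ-p i i'
  nonHom-wholeClasses i i' t t' i<k i'<k t<c t'<c =
    subst₂ _≤_ (sym (nonHomℕ-fromℕ< q _ _ lt lt')) (sym (nonHomℕ-fromℕ< p i i' i<k i'<k))
      (nonHom-⊆ G p q (wholeClass⊆part i t i<k t<c lt) (wholeClass⊆part i' t' i'<k t'<c lt'))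
    where
    inRange : ∀ i t → i < k → t < wholeClasses i → classesBefore i + t < K
    inRange i t i<k t<c = <-≤-trans
      (subst (classesBefore i + t <_) (sym (classesBefore-suc i)) (+-monoʳ-< (classesBefore i) t<c))
      (≤-trans (classesBefore-mono i<k) classesBefore-k≤K)
    lt = inRange i t i<k t<c
    lt' = inRange i' t' i'<k t'<c

  nonHomCount-bound : nonHomCount G q * (n * n) ≤ 2 * K * k * (n * n) + K * K * nonHomWeight G p
  nonHomCount-bound = begin
    nonHomCount G q * (n * n)                  ≤⟨ *-monoˡ-≤ (n * n) count ⟩
    (P + 2 * K * k) * (n * n)                  ≡⟨ *-distribʳ-+ (n * n) P (2 * K * k) ⟩
    P * (n * n) + 2 * K * k * (n * n)          ≤⟨ +-monoˡ-≤ _ (Σ²-rescale k wholeClasses partSize nonHomℕ-p n K wholeClasses-lo) ⟩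
    K * K * Σ< k (λ i → Σ< k (λ i' → nonHomℕ-p i i' * (partSize i * partSize i'))) + 2 * K * k * (n * n)
                                               ≡⟨ cong (λ w → K * K * w + 2 * K * k * (n * n)) (sym nonHomWeight-p) ⟩
    K * K * nonHomWeight G p + 2 * K * k * (n * n) ≡⟨ +-comm (K * K * nonHomWeight G p) _ ⟩
    2 * K * k * (n * n) + K * K * nonHomWeight G p ∎
    where
    open ≤-Reasoning
    C = classesBefore k
    P = Σ< k (λ i → wholeClasses i * Σ< k (λ i' → wholeClasses i' * nonHomℕ-p i i'))
    impure≤k : K ∸ C ≤ k
    impure≤k = subst (K ∸ C ≤_) (m+n∸n≡m k C) (∸-monoˡ-≤ C K≤k+classesBefore-k)
    count : nonHomCount G q ≤ P + 2 * K * k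
    count = begin
      nonHomCount G q                    ≡⟨ nonHomCount-q ⟩
      Σ² K nonHomℕ-q                     ≤⟨ Σ²-restrict K C nonHomℕ-q classesBefore-k≤K nonHomℕ-q≤1 ⟩
      Σ² C nonHomℕ-q + 2 * K * (K ∸ C)   ≤⟨ +-mono-≤ (Σ²-blocks k wholeClasses nonHomℕ-q nonHomℕ-p nonHom-wholeClasses)
                                                     (*-monoʳ-≤ (2 * K) impure≤k) ⟩
      P + 2 * K * k                      ∎

interval-equipartition : ∀ {n k K} (G : Graph n) (p : Fin n → Fin k) → 0 < n → 0 < K →
  Σ[ q ∈ (Fin n → Fin K) ] (Equipartition q ×
    nonHomCount G q * (n * n) ≤ 2 * K * k * (n * n) + K * K * nonHomWeight G p)
interval-equipartition {suc n'} {k} {suc K'} G p _ _ = q , q-equipartition , nonHomCount-bound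
  where open Construction n' K' k G p

-- A nice partition has vertices: its weight W ≥ 0 is below εn².
nice⇒nonempty : ∀ ε {n k} (G : Graph n) (p : Fin n → Fin k) → Nice ε G p → 0 < n
nice⇒nonempty ε {zero}  G p nice = ⊥-elim (ℚP.<-irrefl refl
  (ℚP.≤-<-trans (ℕtoℚ-mono (z≤n {nonHomWeight G p})) (subst (ℕtoℚ (nonHomWeight G p) ℚ.<_) (*-ℕtoℚ0 ε) nice)))
nice⇒nonempty ε {suc n} G p nice = z<s

nonempty⇒parts : ∀ {n k} → 0 < n → (Fin n → Fin k) → 0 < k
nonempty⇒parts {suc n} {zero}  _ p with p F.zero
... | ()
nonempty⇒parts {suc n} {suc k} _ p = z<s

mainTheorem18 : (ε : ℚ) .{{_ : Positive ε}} (n k : ℕ) (G : Graph n) (p : Fin n → Fin k) →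
    Nice ε G p →
    Σ[ q ∈ (Fin n → Fin (ceilDiv k ε)) ]
      (Equipartition q ×
       ℕtoℚ (nonHomCount G q) ℚ.≤ ℕtoℚ 3 ℚ.* ε ℚ.* ℕtoℚ (ceilDiv k ε * ceilDiv k ε))
mainTheorem18 ε n k G p nice =
  q , q-equipartition , fraction-bound ε n k K (nonHomCount G q) (nonHomWeight G p) n>0 nice k≤εK counted
  where
  K = ceilDiv k ε
  k≤εK = k≤ε*ceilDiv ε k
  n>0 = nice⇒nonempty ε G p nice
  K>0 = k≤εK⇒K>0 ε (nonempty⇒parts n>0 p) k≤εK
  construction = interval-equipartition {K = K} G p n>0 K>0
  q = proj₁ construction
  q-equipartition = proj₁ (proj₂ construction)
  counted = proj₂ (proj₂ construction)
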